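{- Let $G$ be a graph of order $n$ that is a disjoint union of half-graphs $B_{k}$ (each with $k\ge2$). Then $\gamma^{\mathrm{FTD}}(G)=n$ and $\gamma^{\mathrm{FD}}(G+K_1)=\gamma^{\mathrm{FTD}}(G)+1=n+1$, where $G+K_1$ is the disjoint union of $G$ with a single isolated vertex.
   Context: For an integer $k\ge1$, the half-graph $B_k$ is the bipartite graph with vertex set $\{u_1,\dots,u_k\}\cup\{w_1,\dots,w_k\}$ and edges $u_iw_j$ exactly when $i\le j$. For a vertex $v$, $N(v)$ is its open and $N[v]=N(v)\cup\{v\}$ its closed neighborhood. A vertex set $C$ is full-separating if for all distinct $u,v$, $(N(v)\cap C)\setminus\{u\}\neq(N(u)\cap C)\setminus\{v\}$; dominating if $N[v]\cap C\neq\emptyset$ for all $v$; total-dominating if $N(v)\cap C\neq\emptyset$ for all $v$. An FD-code is a full-separating dominating set and an FTD-code a full-separating total-dominating set; $\gamma^{\mathrm{FD}}$, $\gamma^{\mathrm{FTD}}$ denote their minimum cardinalities. -}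

module Defs where

open import Data.Nat using (ℕ; zero; suc; _+_; _≤_; _≤ᵇ_)
open import Data.Bool using (Bool; true; false)
open import Data.Fin using (Fin; toℕ; splitAt)
open import Data.Sum using (_⊎_; inj₁; inj₂)
open import Data.List using (List; []; _∷_)
open import Data.Vec using (tabulate)
open import Data.Product using (Σ; _×_)
open import Data.Empty using (⊥)
open import Relation.Binary.PropositionalEquality using (_≡_; _≢_)
open import Data.Fin.Subset using (Subset; _∈_; _∩_; _-_; ∣_∣)

Graph : ℕ → Set
Graph n = Fin n → Fin n → Bool

-- Half-graph B_k on Fin (k + k): the first k vertices are u_1..u_k,
-- the last k are w_1..w_k (0-indexed here); u_i w_j is an edge iff i ≤ j.
halfAdj : (k : ℕ) → Fin k ⊎ Fin k → Fin k ⊎ Fin k → Bool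
halfAdj k (inj₁ i) (inj₂ j) = toℕ i ≤ᵇ toℕ j
halfAdj k (inj₂ j) (inj₁ i) = toℕ i ≤ᵇ toℕ j
halfAdj k (inj₁ _) (inj₁ _) = false
halfAdj k (inj₂ _) (inj₂ _) = false

halfGraph : (k : ℕ) → Graph (k + k)
halfGraph k x y = halfAdj k (splitAt k x) (splitAt k y)

unionAdj : {m n : ℕ} → Graph m → Graph n → Fin m ⊎ Fin n → Fin m ⊎ Fin n → Bool
unionAdj G H (inj₁ x) (inj₁ y) = G x y
unionAdj G H (inj₂ x) (inj₂ y) = H x y
unionAdj G H (inj₁ _) (inj₂ _) = false
unionAdj G H (inj₂ _) (inj₁ _) = false

_⊕_ : {m n : ℕ} → Graph m → Graph n → Graph (m + n)
_⊕_ {m} G H x y = unionAdj G H (splitAt m x) (splitAt m y)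

K₁ : Graph 1
K₁ _ _ = false

order : List ℕ → ℕ
order [] = 0
order (k ∷ ks) = (k + k) + order ks

unionHalf : (ks : List ℕ) → Graph (order ks)
unionHalf [] ()
unionHalf (k ∷ ks) = halfGraph k ⊕ unionHalf ks

N : {n : ℕ} → Graph n → Fin n → Subset n
N G v = tabulate (G v)

ClosedNbr : {n : ℕ} → Graph n → Fin n → Fin n → Set
ClosedNbr G v w = (w ≡ v) ⊎ (w ∈ N G v)

FullSeparating : {n : ℕ} → Graph n → Subset n → Set
FullSeparating G C = ∀ u v → u ≢ v → ((N G v ∩ C) - u) ≢ ((N G u ∩ C) - v)

Dominating : {n : ℕ} → Graph n → Subset n → Set
Dominating G C = ∀ v → Σ _ λ w → ClosedNbr G v w × w ∈ C

TotalDominating : {n : ℕ} → Graph n → Subset n → Set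
TotalDominating G C = ∀ v → Σ _ λ w → w ∈ N G v × w ∈ C

FDCode : {n : ℕ} → Graph n → Subset n → Set
FDCode G C = FullSeparating G C × Dominating G C

FTDCode : {n : ℕ} → Graph n → Subset n → Set
FTDCode G C = FullSeparating G C × TotalDominating G C

IsMinCard : {n : ℕ} → (Subset n → Set) → ℕ → Set
IsMinCard {n} P m = (Σ (Subset n) λ C → P C × ∣ C ∣ ≡ m) × (∀ C → P C → m ≤ ∣ C ∣)

γFD≡ : {n : ℕ} → Graph n → ℕ → Set
γFD≡ G m = IsMinCard (FDCode G) m

γFTD≡ : {n : ℕ} → Graph n → ℕ → Set
γFTD≡ G m = IsMinCard (FTDCode G) m

-- A vertex is forced into every FTD-code if it is the only neighbour of some vertex
-- (total domination) or the only vertex whose membership tells two vertices apart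
-- (full separation); an isolated vertex is forced into every FD-code. In B_k, u₀ and
-- w_{k-1} are only neighbours of the leaves w₀ and u_{k-1}, u_{i+1} alone separates
-- w_i from w_{i+1}, and w_i alone separates u_i from u_{i+1}; so every vertex of a
-- union of half-graphs is forced, while the whole vertex set is an FTD-code. In
-- G + K₁ the new vertex is isolated and each former only neighbour now alone
-- separates its leaf from the new vertex.
module Submission where

open import Defs
open import Data.Bool using (Bool; true; false; _∧_)
open import Data.Bool.Properties using (∧-identityʳ; ∧-zeroʳ; T-≡)
open import Data.Empty using (⊥-elim)
open import Data.Fin using (Fin; zero; suc; toℕ; fromℕ; inject₁; _≟_)
open import Data.Fin.Properties using (+↔⊎; toℕ-injective; toℕ-inject₁; ≤fromℕ; suc-injective)
open import Data.Fin.Subset using (Subset; _∈_; _∩_; _-_; ∣_∣; ⊤)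
open import Data.Fin.Subset.Properties using (∈⊤; ∣⊤∣≡n; p⊆q⇒∣p∣≤∣q∣; p─⊥≡p)
open import Data.List using (List; []; _∷_)
open import Data.List.Relation.Unary.All using (All; []; _∷_)
open import Data.Nat using (ℕ; zero; suc; _+_; _≤_; _≤ᵇ_; s≤s; s≤s⁻¹)
open import Data.Nat.Properties
  using (_≤?_; ≤ᵇ⇒≤; ≤-refl; ≤-antisym; ≤-trans; <-cmp; <⇒≱; ≤∧≢⇒<; m≤n⇒m≤1+n; n≤1+n)
open import Data.Product using (Σ; _×_; _,_)
import Data.Sum as Sum
open import Data.Sum using (_⊎_; inj₁; inj₂)
open import Data.Sum.Properties using (inj₁-injective; inj₂-injective)
open import Data.Vec using (_∷_; lookup)
open import Data.Vec.Properties
  using (lookup∘tabulate; tabulate∘lookup; tabulate-cong; lookup-zipWith; lookup-replicate;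
         lookup⇒[]=; []=⇒lookup)
open import Function using (_∘_; _on_; Equivalence; mk⇔)
open import Function.Bundles using (Inverse; _↔_)
open import Relation.Binary.Definitions using (tri<; tri≈; tri>)
open import Relation.Binary.PropositionalEquality
  using (_≡_; _≢_; refl; sym; trans; cong; subst; ≢-sym)
open import Relation.Nullary using (¬_; yes; no)
open import Relation.Nullary.Decidable using (dec-true; dec-false; does-⇔)

true≢false : true ≢ false
true≢false ()

module _ {V : Set} (E : V → V → Bool) where

  Loopless : Set
  Loopless = ∀ v → E v v ≡ false

  HasNeighbour : V → Set
  HasNeighbour v = Σ V λ w → E v w ≡ true

  Isolated : V → Set
  Isolated v = ∀ w → E v w ≢ true

  Separable : Set
  Separable = ∀ u v → u ≢ v → Σ V λ w → w ≢ u × w ≢ v × E v w ≢ E u w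

  SoleNeighbour : V → Set
  SoleNeighbour x = Σ V λ y → ∀ w → E y w ≡ true → w ≡ x

  SoleSeparator : V → Set
  SoleSeparator x =
    Σ V λ u → Σ V λ v → u ≢ v × (∀ w → w ≢ x → w ≢ u → w ≢ v → E v w ≡ E u w)

  neighbour≢ : Loopless → ∀ {a w} → E a w ≡ true → w ≢ a
  neighbour≢ loopless {a} e refl = true≢false (trans (sym e) (loopless a))

  record FTDForced : Set where
    field
      loopless   : Loopless
      noIsolated : ∀ v → HasNeighbour v
      separable  : Separable
      forced     : ∀ x → SoleNeighbour x ⊎ SoleSeparator x

  record FDForced : Set where
    field
      loopless  : Loopless
      separable : Separable
      forced    : ∀ x → Isolated x ⊎ SoleSeparator x

module _ {A B : Set} (f : A ↔ B) (E : B → B → Bool) where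
  open Inverse f

  private
    to-injective : ∀ {a a′} → to a ≡ to a′ → a ≡ a′
    to-injective {a} {a′} e =
      trans (sym (strictlyInverseʳ a)) (trans (cong from e) (strictlyInverseʳ a′))

    from-injective : ∀ {b b′} → from b ≡ from b′ → b ≡ b′
    from-injective {b} {b′} e =
      trans (sym (strictlyInverseˡ b)) (trans (cong to e) (strictlyInverseˡ b′))

    to-≢ : ∀ {a b} → a ≢ from b → to a ≢ b
    to-≢ a≢ e = a≢ (trans (sym (strictlyInverseʳ _)) (cong from e))

    from-≢ : ∀ {a b} → b ≢ to a → from b ≢ a
    from-≢ b≢ e = b≢ (trans (sym (strictlyInverseˡ _)) (cong to e))

    from-on : ∀ b a → (E on to) (from b) a ≡ E b (to a)
    from-on b a = cong (λ z → E z (to a)) (strictlyInverseˡ b)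

  separable-on : Separable E → Separable (E on to)
  separable-on sep u v u≢v with sep (to u) (to v) (u≢v ∘ to-injective)
  ... | w , w≢u , w≢v , differ =
    from w , from-≢ w≢u , from-≢ w≢v ,
    subst (λ z → E (to v) z ≢ E (to u) z) (sym (strictlyInverseˡ w)) differ

  soleNeighbour-on : ∀ {x} → SoleNeighbour E (to x) → SoleNeighbour (E on to) x
  soleNeighbour-on (y , only) =
    from y , λ w e → to-injective (only (to w) (trans (sym (from-on y w)) e))

  soleSeparator-on : ∀ {x} → SoleSeparator E (to x) → SoleSeparator (E on to) x
  soleSeparator-on (u , v , u≢v , agree) =
    from u , from v , u≢v ∘ from-injective , λ w w≢x w≢u w≢v →
      trans (from-on v w)
        (trans (agree (to w) (w≢x ∘ to-injective) (to-≢ w≢u) (to-≢ w≢v)) (sym (from-on u w)))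

  FTDForced-on : FTDForced E → FTDForced (E on to)
  FTDForced-on G = record
    { loopless   = loopless ∘ to
    ; noIsolated = λ a → let (w , e) = noIsolated (to a) in
                         from w , trans (cong (E (to a)) (strictlyInverseˡ w)) e
    ; separable  = separable-on separable
    ; forced     = Sum.map soleNeighbour-on soleSeparator-on ∘ forced ∘ to
    }
    where open FTDForced G

  FDForced-on : FDForced E → FDForced (E on to)
  FDForced-on G = record
    { loopless  = loopless ∘ to
    ; separable = separable-on separable
    ; forced    = Sum.map (λ iso → iso ∘ to) soleSeparator-on ∘ forced ∘ to
    }
    where open FDForced G

module _ {m n : ℕ} (G : Graph m) (H : Graph n) where

  private
    U : Fin m ⊎ Fin n → Fin m ⊎ Fin n → Bool
    U = unionAdj G H

  separable-union : Loopless G → (∀ a → HasNeighbour G a) →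
                    Separable G → Separable H → Separable U
  separable-union _ _ sepG _ (inj₁ a) (inj₁ b) a≢b with sepG a b (a≢b ∘ cong inj₁)
  ... | w , w≢a , w≢b , differ =
    inj₁ w , w≢a ∘ inj₁-injective , w≢b ∘ inj₁-injective , differ
  separable-union _ _ _ sepH (inj₂ a) (inj₂ b) a≢b with sepH a b (a≢b ∘ cong inj₂)
  ... | w , w≢a , w≢b , differ =
    inj₂ w , w≢a ∘ inj₂-injective , w≢b ∘ inj₂-injective , differ
  separable-union loopless nbr _ _ (inj₁ a) (inj₂ b) _ with nbr a
  ... | w , e = inj₁ w , neighbour≢ G loopless e ∘ inj₁-injective , (λ ()) ,
                λ f≡e → true≢false (sym (trans f≡e e))
  separable-union loopless nbr _ _ (inj₂ b) (inj₁ a) _ with nbr a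
  ... | w , e = inj₁ w , (λ ()) , neighbour≢ G loopless e ∘ inj₁-injective ,
                λ e≡f → true≢false (trans (sym e) e≡f)

  soleSeparator-inj₁ : ∀ {x} → SoleSeparator G x → SoleSeparator U (inj₁ x)
  soleSeparator-inj₁ (u , v , u≢v , agree) =
    inj₁ u , inj₁ v , u≢v ∘ inj₁-injective ,
    λ { (inj₁ w) w≢x w≢u w≢v → agree w (w≢x ∘ cong inj₁) (w≢u ∘ cong inj₁) (w≢v ∘ cong inj₁)
      ; (inj₂ w) _ _ _ → refl }

  soleSeparator-inj₂ : ∀ {x} → SoleSeparator H x → SoleSeparator U (inj₂ x)
  soleSeparator-inj₂ (u , v , u≢v , agree) =
    inj₂ u , inj₂ v , u≢v ∘ inj₂-injective ,
    λ { (inj₂ w) w≢x w≢u w≢v → agree w (w≢x ∘ cong inj₂) (w≢u ∘ cong inj₂) (w≢v ∘ cong inj₂)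
      ; (inj₁ w) _ _ _ → refl }

  soleNeighbour-inj₁ : ∀ {x} → SoleNeighbour G x → SoleNeighbour U (inj₁ x)
  soleNeighbour-inj₁ (y , only) = inj₁ y , λ { (inj₁ w) e → cong inj₁ (only w e) ; (inj₂ _) () }

  soleNeighbour-inj₂ : ∀ {x} → SoleNeighbour H x → SoleNeighbour U (inj₂ x)
  soleNeighbour-inj₂ (y , only) = inj₂ y , λ { (inj₂ w) e → cong inj₂ (only w e) ; (inj₁ _) () }

FTDForced-union : ∀ {m n} {G : Graph m} {H : Graph n} →
                  FTDForced G → FTDForced H → FTDForced (unionAdj G H)
FTDForced-union {G = G} {H} FG FH = record
  { loopless   = λ { (inj₁ a) → G.loopless a ; (inj₂ b) → H.loopless b }
  ; noIsolated = λ { (inj₁ a) → let (w , e) = G.noIsolated a in inj₁ w , e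
                   ; (inj₂ b) → let (w , e) = H.noIsolated b in inj₂ w , e }
  ; separable  = separable-union G H G.loopless G.noIsolated G.separable H.separable
  ; forced     = λ { (inj₁ a) → Sum.map (soleNeighbour-inj₁ G H) (soleSeparator-inj₁ G H) (G.forced a)
                   ; (inj₂ b) → Sum.map (soleNeighbour-inj₂ G H) (soleSeparator-inj₂ G H) (H.forced b) }
  }
  where
  module G = FTDForced FG
  module H = FTDForced FH

soleNeighbour⇒soleSeparator-K₁ : ∀ {n} (G : Graph n) {x} →
  SoleNeighbour G x → SoleSeparator (unionAdj G K₁) (inj₁ x)
soleNeighbour⇒soleSeparator-K₁ G {x} (y , only) = inj₁ y , inj₂ zero , (λ ()) , agree
  where
  agree : ∀ w → w ≢ inj₁ x → w ≢ inj₁ y → w ≢ inj₂ zero →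
          unionAdj G K₁ (inj₂ zero) w ≡ unionAdj G K₁ (inj₁ y) w
  agree (inj₂ _) _ _ _ = refl
  agree (inj₁ w) w≢x _ _ with G y w in e
  ... | true  = ⊥-elim (w≢x (cong inj₁ (only w e)))
  ... | false = refl

FDForced-unionK₁ : ∀ {n} {G : Graph n} → FTDForced G → FDForced (unionAdj G K₁)
FDForced-unionK₁ {G = G} FG = record
  { loopless  = λ { (inj₁ a) → loopless a ; (inj₂ _) → refl }
  ; separable = separable-union G K₁ loopless noIsolated separable
                  (λ { zero zero 0≢0 → ⊥-elim (0≢0 refl) })
  ; forced    = λ { (inj₁ a) → inj₂ (Sum.[ soleNeighbour⇒soleSeparator-K₁ G
                                         , soleSeparator-inj₁ G K₁ ] (forced a))
                  ; (inj₂ _) → inj₁ λ { (inj₁ _) () ; (inj₂ _) () } }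
  }
  where open FTDForced FG

-- These use that does (m ≤? n) is definitionally m ≤ᵇ n.
≤ᵇ-false≢true : ∀ {a b c d} → ¬ a ≤ b → c ≤ d → (a ≤ᵇ b) ≢ (c ≤ᵇ d)
≤ᵇ-false≢true {a} {b} {c} {d} a≰b c≤d e =
  true≢false (trans (sym (dec-true (c ≤? d) c≤d)) (trans (sym e) (dec-false (a ≤? b) a≰b)))

≤ᵇ-suc-right : ∀ {l i} → l ≢ suc i → (l ≤ᵇ suc i) ≡ (l ≤ᵇ i)
≤ᵇ-suc-right {l} {i} l≢1+i =
  does-⇔ (mk⇔ (λ l≤1+i → s≤s⁻¹ (≤∧≢⇒< l≤1+i l≢1+i)) m≤n⇒m≤1+n) (l ≤? suc i) (l ≤? i)

≤ᵇ-suc-left : ∀ {l i} → l ≢ i → (suc i ≤ᵇ l) ≡ (i ≤ᵇ l)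
≤ᵇ-suc-left {l} {i} l≢i =
  does-⇔ (mk⇔ (≤-trans (n≤1+n i)) (λ i≤l → ≤∧≢⇒< i≤l (≢-sym l≢i))) (suc i ≤? l) (i ≤? l)

≤ᵇ≡true⇒≤ : ∀ {a b} → (a ≤ᵇ b) ≡ true → a ≤ b
≤ᵇ≡true⇒≤ {a} {b} e = ≤ᵇ⇒≤ a b (Equivalence.from T-≡ e)

inject₁≢suc : ∀ {n} (i : Fin n) → inject₁ i ≢ suc i
inject₁≢suc zero    ()
inject₁≢suc (suc i) e = inject₁≢suc i (suc-injective e)

data LastView : ∀ {n} → Fin (suc n) → Set where
  last  : ∀ {n} → LastView (fromℕ n)
  inner : ∀ {n} (i : Fin n) → LastView (inject₁ i)

lastView : ∀ {n} (j : Fin (suc n)) → LastView j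
lastView {zero}  zero    = last
lastView {suc n} zero    = inner zero
lastView {suc n} (suc j) with lastView j
... | last    = last
... | inner i = inner (suc i)

module HalfGraph (m : ℕ) where

  private
    k : ℕ
    k = suc (suc m)

    E : Fin k ⊎ Fin k → Fin k ⊎ Fin k → Bool
    E = halfAdj k

  separable : Separable E
  separable (inj₁ i) (inj₁ j) i≢j with <-cmp (toℕ i) (toℕ j)
  ... | tri< i<j _ _ = inj₂ i , (λ ()) , (λ ()) , ≤ᵇ-false≢true (<⇒≱ i<j) (≤-refl {toℕ i})
  ... | tri≈ _ i≡j _ = ⊥-elim (i≢j (cong inj₁ (toℕ-injective i≡j)))
  ... | tri> _ _ j<i = inj₂ j , (λ ()) , (λ ()) , ≢-sym (≤ᵇ-false≢true (<⇒≱ j<i) (≤-refl {toℕ j}))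
  separable (inj₂ i) (inj₂ j) i≢j with <-cmp (toℕ i) (toℕ j)
  ... | tri< i<j _ _ = inj₁ j , (λ ()) , (λ ()) , ≢-sym (≤ᵇ-false≢true (<⇒≱ i<j) (≤-refl {toℕ j}))
  ... | tri≈ _ i≡j _ = ⊥-elim (i≢j (cong inj₂ (toℕ-injective i≡j)))
  ... | tri> _ _ j<i = inj₁ i , (λ ()) , (λ ()) , ≤ᵇ-false≢true (<⇒≱ j<i) (≤-refl {toℕ i})
  separable (inj₁ (suc i)) (inj₂ j)       _ = inj₁ zero , (λ ()) , (λ ()) , λ ()
  separable (inj₁ zero)    (inj₂ (suc j)) _ = inj₂ zero , (λ ()) , (λ ()) , λ ()
  separable (inj₁ zero)    (inj₂ zero)    _ = inj₂ (suc zero) , (λ ()) , (λ ()) , λ ()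
  separable (inj₂ j)       (inj₁ (suc i)) _ = inj₁ zero , (λ ()) , (λ ()) , λ ()
  separable (inj₂ (suc j)) (inj₁ zero)    _ = inj₂ zero , (λ ()) , (λ ()) , λ ()
  separable (inj₂ zero)    (inj₁ zero)    _ = inj₂ (suc zero) , (λ ()) , (λ ()) , λ ()

  forced : ∀ x → SoleNeighbour E x ⊎ SoleSeparator E x
  forced (inj₁ zero) = inj₁ (inj₂ zero , only)
    where
    only : ∀ w → E (inj₂ zero) w ≡ true → w ≡ inj₁ zero
    only (inj₁ zero) _ = refl
  forced (inj₁ (suc i)) = inj₂ (inj₂ (inject₁ i) , inj₂ (suc i) ,
                                inject₁≢suc i ∘ inj₂-injective , agree)
    where
    agree : ∀ w → w ≢ inj₁ (suc i) → w ≢ inj₂ (inject₁ i) → w ≢ inj₂ (suc i) →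
            E (inj₂ (suc i)) w ≡ E (inj₂ (inject₁ i)) w
    agree (inj₂ _) _ _ _ = refl
    agree (inj₁ l) l≢1+i _ _ rewrite toℕ-inject₁ i =
      ≤ᵇ-suc-right (l≢1+i ∘ cong inj₁ ∘ toℕ-injective)
  forced (inj₂ j) with lastView j
  ... | last = inj₁ (inj₁ (fromℕ (suc m)) , only)
    where
    only : ∀ w → E (inj₁ (fromℕ (suc m))) w ≡ true → w ≡ inj₂ (fromℕ (suc m))
    only (inj₂ l) e = cong inj₂ (toℕ-injective (≤-antisym (≤fromℕ l) (≤ᵇ≡true⇒≤ e)))
  ... | inner i = inj₂ (inj₁ (inject₁ i) , inj₁ (suc i) ,
                        inject₁≢suc i ∘ inj₁-injective , agree)
    where
    agree : ∀ w → w ≢ inj₂ (inject₁ i) → w ≢ inj₁ (inject₁ i) → w ≢ inj₁ (suc i) →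
            E (inj₁ (suc i)) w ≡ E (inj₁ (inject₁ i)) w
    agree (inj₁ _) _ _ _ = refl
    agree (inj₂ l) l≢i _ _ rewrite toℕ-inject₁ i =
      ≤ᵇ-suc-left λ l≡i → l≢i (cong inj₂ (toℕ-injective (trans l≡i (sym (toℕ-inject₁ i)))))

  ftdForced : FTDForced E
  ftdForced = record
    { loopless   = λ { (inj₁ _) → refl ; (inj₂ _) → refl }
    ; noIsolated = λ { (inj₁ i) → inj₂ i , dec-true (toℕ i ≤? toℕ i) ≤-refl
                     ; (inj₂ _) → inj₁ zero , refl }
    ; separable  = separable
    ; forced     = forced
    }

unionHalf-FTDForced : ∀ ks → All (2 ≤_) ks → FTDForced (unionHalf ks)
unionHalf-FTDForced [] [] = record
  { loopless = λ () ; noIsolated = λ () ; separable = λ () ; forced = λ () }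
unionHalf-FTDForced (suc (suc m) ∷ ks) (s≤s (s≤s _) ∷ 2≤ks) =
  FTDForced-on +↔⊎ _
    (FTDForced-union (FTDForced-on +↔⊎ _ (HalfGraph.ftdForced m)) (unionHalf-FTDForced ks 2≤ks))

lookup-minus : ∀ {n} (p : Subset n) {u w} → w ≢ u → lookup (p - u) w ≡ lookup p w
lookup-minus (_ ∷ _) {zero}  {zero}  w≢u = ⊥-elim (w≢u refl)
lookup-minus (_ ∷ p) {zero}  {suc w} _   = cong (λ q → lookup q w) (p─⊥≡p p)
lookup-minus (_ ∷ _) {suc _} {zero}  _   = refl
lookup-minus (_ ∷ p) {suc _} {suc _} w≢u = lookup-minus p (w≢u ∘ cong suc)

lookup-minus-self : ∀ {n} (p : Subset n) u → lookup (p - u) u ≡ false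
lookup-minus-self (_ ∷ _) zero    = refl
lookup-minus-self (_ ∷ p) (suc u) = lookup-minus-self p u

subset-ext : ∀ {n} {p q : Subset n} → (∀ w → lookup p w ≡ lookup q w) → p ≡ q
subset-ext {p = p} {q} eq = trans (sym (tabulate∘lookup p)) (trans (tabulate-cong eq) (tabulate∘lookup q))

all∈⇒n≤∣C∣ : ∀ {n} (C : Subset n) → (∀ x → x ∈ C) → n ≤ ∣ C ∣
all∈⇒n≤∣C∣ {n} C all∈ = subst (_≤ ∣ C ∣) (∣⊤∣≡n n) (p⊆q⇒∣p∣≤∣q∣ {p = ⊤} (λ {x} _ → all∈ x))

module _ {n : ℕ} (G : Graph n) where

  ∈N⇒adjacent : ∀ {v w} → w ∈ N G v → G v w ≡ true
  ∈N⇒adjacent {v} {w} w∈N = trans (sym (lookup∘tabulate (G v) w)) ([]=⇒lookup w∈N)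

  lookup-N∩-minus : ∀ C v {u w} → w ≢ u → lookup ((N G v ∩ C) - u) w ≡ G v w ∧ lookup C w
  lookup-N∩-minus C v {w = w} w≢u =
    trans (lookup-minus (N G v ∩ C) w≢u)
      (trans (lookup-zipWith _∧_ w (N G v) C) (cong (_∧ lookup C w) (lookup∘tabulate (G v) w)))

  ⊤-fullSeparating : Separable G → FullSeparating G ⊤
  ⊤-fullSeparating sep u v u≢v eq with sep u v u≢v
  ... | w , w≢u , w≢v , differ =
    differ (trans (sym (trace⊤ v w≢u)) (trans (cong (λ S → lookup S w) eq) (trace⊤ u w≢v)))
    where
    trace⊤ : ∀ v {u} → w ≢ u → lookup ((N G v ∩ ⊤) - u) w ≡ G v w
    trace⊤ v w≢u = trans (lookup-N∩-minus ⊤ v w≢u)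
      (trans (cong (G v w ∧_) (lookup-replicate w true)) (∧-identityʳ (G v w)))

  -- Outside x, u and v the traces agree by hypothesis; at x they vanish since x ∉ C,
  -- and at u and v both vanish, one by the removal and the other by looplessness.
  traces-agree : Loopless G → ∀ C {x u v} → u ≢ v → lookup C x ≡ false →
    (∀ w → w ≢ x → w ≢ u → w ≢ v → G v w ≡ G u w) → (N G v ∩ C) - u ≡ (N G u ∩ C) - v
  traces-agree loopless C {x} {u} {v} u≢v x∉C agree = subset-ext pointwise
    where
    vanishes-at-self : ∀ {a} b → a ≢ b → lookup ((N G a ∩ C) - b) a ≡ false
    vanishes-at-self {a} b a≢b =
      trans (lookup-N∩-minus C a a≢b) (cong (_∧ lookup C a) (loopless a))

    pointwise : ∀ w → lookup ((N G v ∩ C) - u) w ≡ lookup ((N G u ∩ C) - v) w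
    pointwise w with w ≟ u | w ≟ v | w ≟ x
    ... | yes refl | _        | _        =
      trans (lookup-minus-self (N G v ∩ C) w) (sym (vanishes-at-self v u≢v))
    ... | no _     | yes refl | _        =
      trans (vanishes-at-self u (≢-sym u≢v)) (sym (lookup-minus-self (N G u ∩ C) w))
    ... | no w≢u   | no w≢v   | yes refl =
      trans (lookup-N∩-minus C v w≢u) (trans (cong (G v w ∧_) x∉C)
        (trans (∧-zeroʳ (G v w)) (sym (trans (lookup-N∩-minus C u w≢v)
          (trans (cong (G u w ∧_) x∉C) (∧-zeroʳ (G u w)))))))
    ... | no w≢u   | no w≢v   | no w≢x   =
      trans (lookup-N∩-minus C v w≢u)
        (trans (cong (_∧ lookup C w) (agree w w≢x w≢u w≢v)) (sym (lookup-N∩-minus C u w≢v)))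

  soleSeparator∈ : Loopless G → ∀ {C x} → FullSeparating G C → SoleSeparator G x → x ∈ C
  soleSeparator∈ loopless {C} {x} fs (u , v , u≢v , agree) with lookup C x in eq
  ... | true  = lookup⇒[]= x C eq
  ... | false = ⊥-elim (fs u v u≢v (traces-agree loopless C u≢v eq agree))

  soleNeighbour∈ : ∀ {C x} → TotalDominating G C → SoleNeighbour G x → x ∈ C
  soleNeighbour∈ {C} td (y , only) with td y
  ... | w , w∈N , w∈C = subst (_∈ C) (only w (∈N⇒adjacent w∈N)) w∈C

  isolated∈ : ∀ {C x} → Dominating G C → Isolated G x → x ∈ C
  isolated∈ {x = x} dom iso with dom x
  ... | _ , inj₁ refl , x∈C = x∈C
  ... | w , inj₂ w∈N , _   = ⊥-elim (iso w (∈N⇒adjacent w∈N))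

  γFTD≡order : FTDForced G → γFTD≡ G n
  γFTD≡order FG = (⊤ , (⊤-fullSeparating separable , ⊤-totalDominating) , ∣⊤∣≡n n) ,
    λ C (fs , td) → all∈⇒n≤∣C∣ C (Sum.[ soleNeighbour∈ td , soleSeparator∈ loopless fs ] ∘ forced)
    where
    open FTDForced FG
    ⊤-totalDominating : TotalDominating G ⊤
    ⊤-totalDominating v with noIsolated v
    ... | w , e = w , lookup⇒[]= w (N G v) (trans (lookup∘tabulate (G v) w) e) , ∈⊤

  γFD≡order : FDForced G → γFD≡ G n
  γFD≡order FG = (⊤ , (⊤-fullSeparating separable , λ v → v , inj₁ refl , ∈⊤) , ∣⊤∣≡n n) ,
    λ C (fs , dom) → all∈⇒n≤∣C∣ C (Sum.[ isolated∈ dom , soleSeparator∈ loopless fs ] ∘ forced)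
    where open FDForced FG

corollary5 : (ks : List ℕ) → All (2 ≤_) ks →
    γFTD≡ (unionHalf ks) (order ks)
      × γFD≡ (unionHalf ks ⊕ K₁) (order ks + 1)
corollary5 ks 2≤ks =
  γFTD≡order (unionHalf ks) ftdForced ,
  γFD≡order (unionHalf ks ⊕ K₁) (FDForced-on +↔⊎ _ (FDForced-unionK₁ ftdForced))
  where
  ftdForced : FTDForced (unionHalf ks)
  ftdForced = unionHalf-FTDForced ks 2≤ks
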